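{- Let $(H,w)$ be a weighted graph such that $H$ is a connected randomly internally matchable graph. Then $w(E(H))\le \Delta_w(H)\cdot \nu(H)$.
   Context: All graphs are finite and simple. A weighted graph is a pair $(H,w)$ with $w:E(H)\to\{1,2,3,\dots\}$. For $X\subseteq E(H)$, $w(X)=\sum_{e\in X}w(e)$. For a vertex $v$, $E(v)$ is the set of edges incident to $v$ and $d_w(v)=w(E(v))$; $\Delta_w(H)=\max_v d_w(v)$. $\nu(H)$ is the maximum size of a matching in $H$. An internal vertex is one of degree at least two; a graph is randomly internally matchable if every inclusion-maximal matching saturates all internal vertices. -}

module Defs where

open import Data.Nat using (ℕ; zero; suc; _+_; _≤_; _⊔_)
open import Data.Nat.Base using (_<ᵇ_)
open import Data.Bool using (Bool; true; false; _∧_)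
open import Data.Fin using (Fin; toℕ)
open import Data.Nat.ListAction using (sum)
open import Data.List using (List; []; _∷_; map; length; filterᵇ; allFin; cartesianProduct; foldr)
open import Data.Product using (_×_; _,_; proj₁; proj₂; Σ; ∃; ∃-syntax)
open import Data.Sum using (_⊎_)
open import Relation.Binary.PropositionalEquality using (_≡_)
open import Relation.Nullary using (¬_)

record Graph (n : ℕ) : Set where
  field
    adj    : Fin n → Fin n → Bool
    sym    : ∀ u v → adj u v ≡ adj v u
    irrefl : ∀ v → adj v v ≡ false
open Graph public

edges : ∀ {n} → Graph n → List (Fin n × Fin n)
edges {n} H = filterᵇ (λ p → (toℕ (proj₁ p) <ᵇ toℕ (proj₂ p)) ∧ adj H (proj₁ p) (proj₂ p))
                      (cartesianProduct (allFin n) (allFin n))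

nbrs : ∀ {n} → Graph n → Fin n → List (Fin n)
nbrs {n} H v = filterᵇ (adj H v) (allFin n)

deg : ∀ {n} → Graph n → Fin n → ℕ
deg H v = length (nbrs H v)

-- A weighting: symmetric (so it is a function on unordered edges), positive
-- integer on every edge (values off edges are irrelevant).
record Weighting {n : ℕ} (H : Graph n) : Set where
  field
    wt    : Fin n → Fin n → ℕ
    wsym  : ∀ u v → wt u v ≡ wt v u
    wpos  : ∀ u v → adj H u v ≡ true → 1 ≤ wt u v
open Weighting public

totalWeight : ∀ {n} (H : Graph n) → Weighting H → ℕ
totalWeight H w = sum (map (λ p → wt w (proj₁ p) (proj₂ p)) (edges H))

wdeg : ∀ {n} (H : Graph n) → Weighting H → Fin n → ℕ
wdeg H w v = sum (map (wt w v) (nbrs H v))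

-- Δ_w(H) = max_v d_w(v)  (0 for the empty graph)
maxWDeg : ∀ {n} (H : Graph n) → Weighting H → ℕ
maxWDeg {n} H w = foldr _⊔_ 0 (map (wdeg H w) (allFin n))

record Matching {n : ℕ} (H : Graph n) : Set where
  field
    inM    : Fin n → Fin n → Bool
    msym   : ∀ u v → inM u v ≡ inM v u
    medge  : ∀ u v → inM u v ≡ true → adj H u v ≡ true
    mdisj  : ∀ u v x → inM u v ≡ true → inM u x ≡ true → v ≡ x
open Matching public

msize : ∀ {n} {H : Graph n} → Matching H → ℕ
msize {n} M = length (filterᵇ (λ p → (toℕ (proj₁ p) <ᵇ toℕ (proj₂ p)) ∧ inM M (proj₁ p) (proj₂ p))
                               (cartesianProduct (allFin n) (allFin n)))

Saturates : ∀ {n} {H : Graph n} → Matching H → Fin n → Set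
Saturates {n} M v = ∃[ u ] inM M v u ≡ true

IsMaximal : ∀ {n} {H : Graph n} → Matching H → Set
IsMaximal {n} {H} M = ∀ u v → adj H u v ≡ true → Saturates M u ⊎ Saturates M v

IsMaximum : ∀ {n} {H : Graph n} → Matching H → Set
IsMaximum {n} {H} M = ∀ (M' : Matching H) → msize M' ≤ msize M

Internal : ∀ {n} → Graph n → Fin n → Set
Internal H v = 2 ≤ deg H v

RandomlyInternallyMatchable : ∀ {n} → Graph n → Set
RandomlyInternallyMatchable {n} H =
  ∀ (M : Matching H) → IsMaximal M → ∀ v → Internal H v → Saturates M v

data Reach {n : ℕ} (H : Graph n) : Fin n → Fin n → Set where
  here : ∀ {v} → Reach H v v
  step : ∀ {u v x} → adj H u v ≡ true → Reach H v x → Reach H u x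

Connected : ∀ {n} → Graph n → Set
Connected {n} H = ∀ (u v : Fin n) → Reach H u v

{-# OPTIONS --safe #-}
-- Fix a maximum matching M. In a randomly internally matchable graph every
-- vertex left unsaturated by M is a leaf, and re-routing a matching edge along
-- an alternating path that starts at an unsaturated vertex keeps M maximum.
-- Give each matching edge {u,p} mass 2, all of it to u if u has a leaf
-- neighbour and p has none, one to each end otherwise; unsaturated vertices get
-- 0. The alternating-path arguments show y u + y v ≥ 2 on every edge, i.e. y/2
-- is a fractional vertex cover of size |M|, and weak duality gives
--   2 w(E) = Σ_{u,v} w(uv) ≤ Σ_u y u · d_w(u) ≤ Δ_w · Σ_u y u = 2 Δ_w |M|.
module Submission where

open import Defs hiding (sym)
open import Data.Bool using (Bool; true; false; T; _∧_; _∨_; not; if_then_else_)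
open import Data.Fin using (Fin; zero; suc; toℕ)
open import Data.Bool.Properties
  using (∧-comm; ∨-comm; ∨-zeroʳ; ∧-conicalˡ; ∧-conicalʳ; ⇔→≡) renaming (_≟_ to _≟ᵇ_)
open import Data.Fin.Properties using (toℕ-injective; suc-injective; _≟_; any?)
open import Data.List
  using (List; []; _∷_; _++_; map; length; filterᵇ; allFin; cartesianProduct; foldr; tabulate)
open import Data.List.Properties using (map-tabulate; map-++; map-∘; map-cong)
open import Data.Nat using (ℕ; zero; suc; _+_; _*_; _≤_; _≤?_; _⊔_; _<ᵇ_; z≤n; s≤s)
open import Data.Nat.ListAction using (sum)
open import Data.Nat.ListAction.Properties using (sum-++)
open import Data.Nat.Properties
  using ( +-*-semiring; +-comm; +-identityʳ; *-comm; *-assoc; *-identityʳ; *-zeroʳ; *-distribʳ-+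
        ; ≤-trans; ≤-reflexive; ≤-pred; <-irrefl; <-asym; <-cmp; <⇒≱; ≰⇒>; n≢0⇒n>0; 1+n≢0
        ; <ᵇ⇒<; <⇒<ᵇ; m≤m+n; m≤n+m; m<m+n; m≤m⊔n; m≤n⊔m
        ; +-mono-≤; +-monoʳ-≤; *-monoˡ-≤; *-monoʳ-≤; *-cancelˡ-≤; *-cancelˡ-≡; module ≤-Reasoning )
  renaming (_≟_ to _≟ℕ_)
open import Data.Product using (_×_; _,_; proj₁; proj₂; ∃)
open import Data.Sum using (_⊎_; inj₁; inj₂; [_,_])
open import Data.Empty using (⊥; ⊥-elim)
open import Function using (_∘_; case_of_; mk⇔)
open import Relation.Binary.PropositionalEquality
  using (_≡_; _≢_; refl; sym; trans; cong; cong₂; subst; subst₂; module ≡-Reasoning)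
open import Relation.Binary.Definitions using (tri<; tri≈; tri>)
open import Relation.Nullary using (¬_; Dec; yes; no; does; _×-dec_)
open import Relation.Nullary.Decidable using (dec-true; dec-false)
open import Algebra.Properties.Semiring.Sum +-*-semiring
  using (sum-cong-≗; ∑-distrib-+; ∑-comm; *-distribˡ-sum; sum-replicate-zero) renaming (sum to ∑)

-- Indicators and finite sums

𝟙 : Bool → ℕ
𝟙 b = if b then 1 else 0

𝟙-∨ : ∀ {x y} → (x ≡ true → y ≡ true → ⊥) → 𝟙 (x ∨ y) ≡ 𝟙 x + 𝟙 y
𝟙-∨ {true}  {true}  disjoint = ⊥-elim (disjoint refl refl)
𝟙-∨ {true}  {false} disjoint = refl
𝟙-∨ {false} {y}     disjoint = refl

𝟙-split : ∀ x y → 𝟙 x ≡ 𝟙 (x ∧ not y) + 𝟙 (x ∧ y)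
𝟙-split true  true  = refl
𝟙-split true  false = refl
𝟙-split false y     = refl

∨-true : ∀ {x y} → x ∨ y ≡ true → x ≡ true ⊎ y ≡ true
∨-true {true}  e = inj₁ refl
∨-true {false} e = inj₂ e

∑∑ : ∀ {n} → (Fin n → Fin n → ℕ) → ℕ
∑∑ f = ∑ (λ u → ∑ (f u))

∑-mono-≤ : ∀ {n} {f g : Fin n → ℕ} → (∀ i → f i ≤ g i) → ∑ f ≤ ∑ g
∑-mono-≤ {zero}  f≤g = z≤n
∑-mono-≤ {suc n} f≤g = +-mono-≤ (f≤g zero) (∑-mono-≤ (f≤g ∘ suc))

∑-zero : ∀ {n} {f : Fin n → ℕ} → (∀ i → f i ≡ 0) → ∑ f ≡ 0
∑-zero {n} f≗0 = trans (sum-cong-≗ f≗0) (sum-replicate-zero n)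

∑-single : ∀ {n} (f : Fin n → ℕ) (p : Fin n) → (∀ i → i ≢ p → f i ≡ 0) → ∑ f ≡ f p
∑-single f zero    off = trans (cong (f zero +_) (∑-zero (λ i → off (suc i) λ ()))) (+-identityʳ (f zero))
∑-single f (suc p) off = trans (cong (_+ ∑ (f ∘ suc)) (off zero λ ()))
  (∑-single (f ∘ suc) p (λ i i≢p → off (suc i) (i≢p ∘ suc-injective)))

∑-≥-point : ∀ {n} (f : Fin n → ℕ) (a : Fin n) → f a ≤ ∑ f
∑-≥-point f zero    = m≤m+n _ _
∑-≥-point f (suc a) = ≤-trans (∑-≥-point (f ∘ suc) a) (m≤n+m _ _)

∑-≥-two-points : ∀ {n} (f : Fin n → ℕ) {a b : Fin n} → a ≢ b → f a + f b ≤ ∑ f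
∑-≥-two-points f {zero}  {zero}  a≢b = ⊥-elim (a≢b refl)
∑-≥-two-points f {zero}  {suc b} a≢b = +-monoʳ-≤ (f zero) (∑-≥-point (f ∘ suc) b)
∑-≥-two-points f {suc a} {zero}  a≢b =
  ≤-trans (≤-reflexive (+-comm (f (suc a)) (f zero))) (+-monoʳ-≤ (f zero) (∑-≥-point (f ∘ suc) a))
∑-≥-two-points f {suc a} {suc b} a≢b =
  ≤-trans (∑-≥-two-points (f ∘ suc) (a≢b ∘ cong suc)) (m≤n+m _ _)

∑-*ˡ : ∀ {n} (c : ℕ) (f : Fin n → ℕ) → ∑ (λ i → c * f i) ≡ c * ∑ f
∑-*ˡ c f = sym (*-distribˡ-sum c f)

module _ {n : ℕ} where

  ∑∑-cong : {f g : Fin n → Fin n → ℕ} → (∀ u v → f u v ≡ g u v) → ∑∑ f ≡ ∑∑ g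
  ∑∑-cong f≗g = sum-cong-≗ (λ u → sum-cong-≗ (f≗g u))

  ∑∑-mono-≤ : {f g : Fin n → Fin n → ℕ} → (∀ u v → f u v ≤ g u v) → ∑∑ f ≤ ∑∑ g
  ∑∑-mono-≤ f≤g = ∑-mono-≤ (λ u → ∑-mono-≤ (f≤g u))

  ∑∑-+ : (f g : Fin n → Fin n → ℕ) → ∑∑ (λ u v → f u v + g u v) ≡ ∑∑ f + ∑∑ g
  ∑∑-+ f g = trans (sum-cong-≗ (λ u → ∑-distrib-+ (f u) (g u)))
                   (∑-distrib-+ (λ u → ∑ (f u)) (λ u → ∑ (g u)))

  ∑∑-*ˡ : (c : ℕ) (f : Fin n → Fin n → ℕ) → ∑∑ (λ u v → c * f u v) ≡ c * ∑∑ f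
  ∑∑-*ˡ c f = trans (sum-cong-≗ (λ u → ∑-*ˡ c (f u))) (∑-*ˡ c (λ u → ∑ (f u)))

  ∑∑-transpose : (f : Fin n → Fin n → ℕ) → ∑∑ (λ u v → f v u) ≡ ∑∑ f
  ∑∑-transpose f = sym (∑-comm f)

  ∑∑-weighted-sym : (f : Fin n → Fin n → ℕ) → (∀ u v → f u v ≡ f v u) → (y : Fin n → ℕ) →
    ∑∑ (λ u v → (y u + y v) * f u v) ≡ 2 * ∑ (λ u → y u * ∑ (f u))
  ∑∑-weighted-sym f f-sym y = begin
      ∑∑ (λ u v → (y u + y v) * f u v)
    ≡⟨ ∑∑-cong (λ u v → *-distribʳ-+ (f u v) (y u) (y v)) ⟩
      ∑∑ (λ u v → y u * f u v + y v * f u v)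
    ≡⟨ ∑∑-+ _ _ ⟩
      ∑∑ yf + ∑∑ (λ u v → y v * f u v)
    ≡⟨ cong (∑∑ yf +_) (trans (∑∑-transpose (λ u v → y u * f v u))
                              (∑∑-cong (λ u v → cong (y u *_) (f-sym v u)))) ⟩
      ∑∑ yf + ∑∑ yf
    ≡⟨ cong (∑∑ yf +_) (sym (+-identityʳ (∑∑ yf))) ⟩
      2 * ∑∑ yf
    ≡⟨ cong (2 *_) (sum-cong-≗ (λ u → ∑-*ˡ (y u) (f u))) ⟩
      2 * ∑ (λ u → y u * ∑ (f u)) ∎
    where
    open ≡-Reasoning
    yf : Fin n → Fin n → ℕ
    yf u v = y u * f u v

  upper : (Fin n → Fin n → ℕ) → Fin n → Fin n → ℕ
  upper f u v = if toℕ u <ᵇ toℕ v then f u v else 0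

  upper-+-transpose : (f : Fin n → Fin n → ℕ) → (∀ u v → f u v ≡ f v u) → (∀ u → f u u ≡ 0) →
    ∀ u v → upper f u v + upper f v u ≡ f u v
  upper-+-transpose f f-sym f-diag u v with toℕ u <ᵇ toℕ v in u<v | toℕ v <ᵇ toℕ u in v<u
  ... | true  | true  =
    ⊥-elim (<-asym (<ᵇ⇒< (toℕ u) (toℕ v) (subst T (sym u<v) _)) (<ᵇ⇒< (toℕ v) (toℕ u) (subst T (sym v<u) _)))
  ... | true  | false = +-identityʳ (f u v)
  ... | false | true  = sym (f-sym u v)
  ... | false | false with <-cmp (toℕ u) (toℕ v)
  ...   | tri< u<v′ _ _ = ⊥-elim (subst T u<v (<⇒<ᵇ u<v′))
  ...   | tri> _ _ v<u′ = ⊥-elim (subst T v<u (<⇒<ᵇ v<u′))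
  ...   | tri≈ _ u≡v _ rewrite toℕ-injective u≡v = sym (f-diag v)

  ∑∑-upper : (f : Fin n → Fin n → ℕ) → (∀ u v → f u v ≡ f v u) → (∀ u → f u u ≡ 0) →
    2 * ∑∑ (upper f) ≡ ∑∑ f
  ∑∑-upper f f-sym f-diag = begin
      2 * ∑∑ (upper f)
    ≡⟨ cong (∑∑ (upper f) +_) (+-identityʳ _) ⟩
      ∑∑ (upper f) + ∑∑ (upper f)
    ≡⟨ cong (∑∑ (upper f) +_) (sym (∑∑-transpose (upper f))) ⟩
      ∑∑ (upper f) + ∑∑ (λ u v → upper f v u)
    ≡⟨ sym (∑∑-+ _ _) ⟩
      ∑∑ (λ u v → upper f u v + upper f v u)
    ≡⟨ ∑∑-cong (upper-+-transpose f f-sym f-diag) ⟩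
      ∑∑ f ∎
    where open ≡-Reasoning

sum-tabulate : ∀ {n} (f : Fin n → ℕ) → sum (tabulate f) ≡ ∑ f
sum-tabulate {zero}  f = refl
sum-tabulate {suc n} f = cong (f zero +_) (sum-tabulate (f ∘ suc))

sum-map-allFin : ∀ {n} (f : Fin n → ℕ) → sum (map f (allFin n)) ≡ ∑ f
sum-map-allFin f = trans (cong sum (map-tabulate (λ i → i) f)) (sum-tabulate f)

foldr-⊔-tabulate : ∀ {n} (f : Fin n → ℕ) (i : Fin n) → f i ≤ foldr _⊔_ 0 (tabulate f)
foldr-⊔-tabulate f zero    = m≤m⊔n _ _
foldr-⊔-tabulate f (suc i) = ≤-trans (foldr-⊔-tabulate (f ∘ suc) i) (m≤n⊔m _ _)

foldr-⊔-map-allFin : ∀ {n} (f : Fin n → ℕ) (i : Fin n) → f i ≤ foldr _⊔_ 0 (map f (allFin n))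
foldr-⊔-map-allFin f i =
  subst (f i ≤_) (cong (foldr _⊔_ 0) (sym (map-tabulate (λ i → i) f))) (foldr-⊔-tabulate f i)

module _ {A : Set} where

  sum-map-filterᵇ : (p : A → Bool) (f : A → ℕ) (xs : List A) →
    sum (map f (filterᵇ p xs)) ≡ sum (map (λ x → if p x then f x else 0) xs)
  sum-map-filterᵇ p f []       = refl
  sum-map-filterᵇ p f (x ∷ xs) with p x
  ... | true  = cong (f x +_) (sum-map-filterᵇ p f xs)
  ... | false = sum-map-filterᵇ p f xs

  length≡sum-map-1 : (xs : List A) → length xs ≡ sum (map (λ _ → 1) xs)
  length≡sum-map-1 []       = refl
  length≡sum-map-1 (x ∷ xs) = cong suc (length≡sum-map-1 xs)

  sum-map-cartesianProduct : ∀ {B : Set} (f : A × B → ℕ) (xs : List A) (ys : List B) →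
    sum (map f (cartesianProduct xs ys)) ≡ sum (map (λ x → sum (map (λ y → f (x , y)) ys)) xs)
  sum-map-cartesianProduct f []       ys = refl
  sum-map-cartesianProduct f (x ∷ xs) ys = begin
      sum (map f (map (x ,_) ys ++ cartesianProduct xs ys))
    ≡⟨ cong sum (map-++ f (map (x ,_) ys) (cartesianProduct xs ys)) ⟩
      sum (map f (map (x ,_) ys) ++ map f (cartesianProduct xs ys))
    ≡⟨ sum-++ (map f (map (x ,_) ys)) _ ⟩
      sum (map f (map (x ,_) ys)) + sum (map f (cartesianProduct xs ys))
    ≡⟨ cong₂ _+_ (cong sum (sym (map-∘ ys))) (sum-map-cartesianProduct f xs ys) ⟩
      sum (map (λ y → f (x , y)) ys) + sum (map (λ x → sum (map (λ y → f (x , y)) ys)) xs) ∎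
    where open ≡-Reasoning

module _ {n : ℕ} where

  upperPairs : (Fin n → Fin n → Bool) → List (Fin n × Fin n)
  upperPairs b = filterᵇ (λ p → (toℕ (proj₁ p) <ᵇ toℕ (proj₂ p)) ∧ b (proj₁ p) (proj₂ p))
                         (cartesianProduct (allFin n) (allFin n))

  restrict : (Fin n → Fin n → Bool) → (Fin n → Fin n → ℕ) → Fin n → Fin n → ℕ
  restrict b g u v = if b u v then g u v else 0

  sum-map-upperPairs : (b : Fin n → Fin n → Bool) (g : Fin n → Fin n → ℕ) →
    sum (map (λ p → g (proj₁ p) (proj₂ p)) (upperPairs b)) ≡ ∑∑ (upper (restrict b g))
  sum-map-upperPairs b g = begin
      sum (map (λ p → g (proj₁ p) (proj₂ p)) (upperPairs b))
    ≡⟨ sum-map-filterᵇ _ _ (cartesianProduct (allFin n) (allFin n)) ⟩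
      sum (map h (cartesianProduct (allFin n) (allFin n)))
    ≡⟨ sum-map-cartesianProduct h (allFin n) (allFin n) ⟩
      sum (map (λ u → sum (map (λ v → h (u , v)) (allFin n))) (allFin n))
    ≡⟨ cong sum (map-cong (λ u → sum-map-allFin (λ v → h (u , v))) (allFin n)) ⟩
      sum (map (λ u → ∑ (λ v → h (u , v))) (allFin n))
    ≡⟨ sum-map-allFin (λ u → ∑ (λ v → h (u , v))) ⟩
      ∑∑ (λ u v → h (u , v))
    ≡⟨ ∑∑-cong h≡upper ⟩
      ∑∑ (upper (restrict b g)) ∎
    where
    open ≡-Reasoning
    h : Fin n × Fin n → ℕ
    h p = if (toℕ (proj₁ p) <ᵇ toℕ (proj₂ p)) ∧ b (proj₁ p) (proj₂ p) then g (proj₁ p) (proj₂ p) else 0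
    h≡upper : ∀ u v → h (u , v) ≡ upper (restrict b g) u v
    h≡upper u v with toℕ u <ᵇ toℕ v
    ... | true  = refl
    ... | false = refl

  double-sum-upperPairs : (b : Fin n → Fin n → Bool) (g : Fin n → Fin n → ℕ) →
    (∀ u v → b u v ≡ b v u) → (∀ u → b u u ≡ false) → (∀ u v → g u v ≡ g v u) →
    2 * sum (map (λ p → g (proj₁ p) (proj₂ p)) (upperPairs b)) ≡ ∑∑ (restrict b g)
  double-sum-upperPairs b g b-sym b-irrefl g-sym =
    trans (cong (2 *_) (sum-map-upperPairs b g)) (∑∑-upper (restrict b g) restrict-sym restrict-diag)
    where
    restrict-sym : ∀ u v → restrict b g u v ≡ restrict b g v u
    restrict-sym u v rewrite b-sym u v | g-sym u v = refl
    restrict-diag : ∀ u → restrict b g u u ≡ 0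
    restrict-diag u rewrite b-irrefl u = refl

  double-length-upperPairs : (b : Fin n → Fin n → Bool) →
    (∀ u v → b u v ≡ b v u) → (∀ u → b u u ≡ false) →
    2 * length (upperPairs b) ≡ ∑∑ (λ u v → 𝟙 (b u v))
  double-length-upperPairs b b-sym b-irrefl =
    trans (cong (2 *_) (length≡sum-map-1 (upperPairs b)))
          (double-sum-upperPairs b (λ _ _ → 1) b-sym b-irrefl (λ _ _ → refl))

-- Weighted degrees and fractional vertex covers

module _ {n : ℕ} (H : Graph n) where

  adj-sym : ∀ {u v} → adj H u v ≡ true → adj H v u ≡ true
  adj-sym {u} {v} uv = trans (Graph.sym H v u) uv

  adj⇒≢ : ∀ {u v} → adj H u v ≡ true → u ≢ v
  adj⇒≢ {u} uv refl with trans (sym uv) (irrefl H u)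
  ... | ()

  weights : Weighting H → Fin n → Fin n → ℕ
  weights w = restrict (adj H) (wt w)

  double-totalWeight : (w : Weighting H) → 2 * totalWeight H w ≡ ∑∑ (weights w)
  double-totalWeight w = double-sum-upperPairs (adj H) (wt w) (Graph.sym H) (irrefl H) (wsym w)

  wdeg≡∑weights : (w : Weighting H) (v : Fin n) → wdeg H w v ≡ ∑ (weights w v)
  wdeg≡∑weights w v =
    trans (sum-map-filterᵇ (adj H v) (wt w v) (allFin n)) (sum-map-allFin (weights w v))

  wdeg≤maxWDeg : (w : Weighting H) (v : Fin n) → wdeg H w v ≤ maxWDeg H w
  wdeg≤maxWDeg w v = foldr-⊔-map-allFin (wdeg H w) v

  deg≡∑adj : (v : Fin n) → deg H v ≡ ∑ (λ x → 𝟙 (adj H v x))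
  deg≡∑adj v = trans (length≡sum-map-1 (nbrs H v))
    (trans (sum-map-filterᵇ (adj H v) (λ _ → 1) (allFin n)) (sum-map-allFin (λ x → 𝟙 (adj H v x))))

  Leaf : Fin n → Set
  Leaf x = deg H x ≤ 1

  two-neighbours⇒¬Leaf : ∀ {x a b} → adj H x a ≡ true → adj H x b ≡ true → a ≢ b → ¬ Leaf x
  two-neighbours⇒¬Leaf {x} {a} {b} xa xb a≢b leaf = <⇒≱ (s≤s leaf) (begin
      2
    ≡⟨ cong₂ (λ p q → 𝟙 p + 𝟙 q) xa xb ⟨
      𝟙 (adj H x a) + 𝟙 (adj H x b)
    ≤⟨ ∑-≥-two-points (λ y → 𝟙 (adj H x y)) a≢b ⟩
      ∑ (λ y → 𝟙 (adj H x y))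
    ≡⟨ deg≡∑adj x ⟨
      deg H x ∎)
    where open ≤-Reasoning

  leaf-neighbour-unique : ∀ {x a b} → Leaf x → adj H x a ≡ true → adj H x b ≡ true → a ≡ b
  leaf-neighbour-unique {a = a} {b} leaf xa xb with a ≟ b
  ... | yes a≡b = a≡b
  ... | no  a≢b = ⊥-elim (two-neighbours⇒¬Leaf xa xb a≢b leaf)

  DoubledFractionalCover : (Fin n → ℕ) → Set
  DoubledFractionalCover y = ∀ u v → adj H u v ≡ true → 2 ≤ y u + y v

  totalWeight-≤-cover : (w : Weighting H) (y : Fin n → ℕ) → DoubledFractionalCover y →
    2 * totalWeight H w ≤ maxWDeg H w * ∑ y
  totalWeight-≤-cover w y cover = *-cancelˡ-≤ 2 (begin
      2 * (2 * totalWeight H w)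
    ≡⟨ cong (2 *_) (double-totalWeight w) ⟩
      2 * ∑∑ A
    ≡⟨ ∑∑-*ˡ 2 A ⟨
      ∑∑ (λ u v → 2 * A u v)
    ≤⟨ ∑∑-mono-≤ weighted-cover ⟩
      ∑∑ (λ u v → (y u + y v) * A u v)
    ≡⟨ ∑∑-weighted-sym A A-sym y ⟩
      2 * ∑ (λ u → y u * ∑ (A u))
    ≤⟨ *-monoʳ-≤ 2 (∑-mono-≤ wdeg-bound) ⟩
      2 * ∑ (λ u → Δ * y u)
    ≡⟨ cong (2 *_) (∑-*ˡ Δ y) ⟩
      2 * (Δ * ∑ y) ∎)
    where
    open ≤-Reasoning
    A = weights w
    Δ = maxWDeg H w
    A-sym : ∀ u v → A u v ≡ A v u
    A-sym u v rewrite Graph.sym H u v | wsym w u v = refl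
    weighted-cover : ∀ u v → 2 * A u v ≤ (y u + y v) * A u v
    weighted-cover u v with adj H u v in uv
    ... | true  = *-monoˡ-≤ (wt w u v) (cover u v uv)
    ... | false = ≤-reflexive (trans (*-zeroʳ 2) (sym (*-zeroʳ (y u + y v))))
    wdeg-bound : ∀ u → y u * ∑ (A u) ≤ Δ * y u
    wdeg-bound u = begin
        y u * ∑ (A u)
      ≡⟨ cong (y u *_) (wdeg≡∑weights w u) ⟨
        y u * wdeg H w u
      ≤⟨ *-monoʳ-≤ (y u) (wdeg≤maxWDeg w u) ⟩
        y u * Δ
      ≡⟨ *-comm (y u) Δ ⟩
        Δ * y u ∎

-- Matchings

module _ {n : ℕ} where

  _≐_ : Fin n → Fin n → Bool
  s ≐ a = does (s ≟ a)

  ≐-refl : ∀ a → a ≐ a ≡ true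
  ≐-refl a = dec-true (a ≟ a) refl

  ≐-false : ∀ {s a} → s ≢ a → s ≐ a ≡ false
  ≐-false {s} {a} = dec-false (s ≟ a)

  ≐-true : ∀ {s a} → s ≐ a ≡ true → s ≡ a
  ≐-true {s} {a} e with s ≟ a
  ... | yes s≡a = s≡a

  ∑∑-point : (a b : Fin n) → ∑∑ (λ s t → 𝟙 (s ≐ a ∧ t ≐ b)) ≡ 1
  ∑∑-point a b = begin
      ∑∑ (λ s t → 𝟙 (s ≐ a ∧ t ≐ b))
    ≡⟨ ∑-single _ a (λ s s≢a → ∑-zero (λ t → cong (λ c → 𝟙 (c ∧ t ≐ b)) (≐-false s≢a))) ⟩
      ∑ (λ t → 𝟙 (a ≐ a ∧ t ≐ b))
    ≡⟨ sum-cong-≗ (λ t → cong (λ c → 𝟙 (c ∧ t ≐ b)) (≐-refl a)) ⟩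
      ∑ (λ t → 𝟙 (t ≐ b))
    ≡⟨ ∑-single _ b (λ t t≢b → cong 𝟙 (≐-false t≢b)) ⟩
      𝟙 (b ≐ b)
    ≡⟨ cong 𝟙 (≐-refl b) ⟩
      1 ∎
    where open ≡-Reasoning

  link : Fin n → Fin n → Fin n → Fin n → Bool
  link a b s t = (s ≐ a ∧ t ≐ b) ∨ (s ≐ b ∧ t ≐ a)

  link-sym : ∀ a b s t → link a b s t ≡ link a b t s
  link-sym a b s t = begin
      (s ≐ a ∧ t ≐ b) ∨ (s ≐ b ∧ t ≐ a)
    ≡⟨ cong₂ _∨_ (∧-comm (s ≐ a) (t ≐ b)) (∧-comm (s ≐ b) (t ≐ a)) ⟩
      (t ≐ b ∧ s ≐ a) ∨ (t ≐ a ∧ s ≐ b)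
    ≡⟨ ∨-comm (t ≐ b ∧ s ≐ a) (t ≐ a ∧ s ≐ b) ⟩
      (t ≐ a ∧ s ≐ b) ∨ (t ≐ b ∧ s ≐ a) ∎
    where open ≡-Reasoning

  link-refl : ∀ a b → link a b a b ≡ true
  link-refl a b rewrite ≐-refl a | ≐-refl b = refl

  link-true : ∀ a b s t → link a b s t ≡ true → (s ≡ a × t ≡ b) ⊎ (s ≡ b × t ≡ a)
  link-true a b s t e with ∨-true {s ≐ a ∧ t ≐ b} e
  ... | inj₁ e′ = inj₁ (≐-true (∧-conicalˡ (s ≐ a) (t ≐ b) e′) , ≐-true (∧-conicalʳ (s ≐ a) (t ≐ b) e′))
  ... | inj₂ e′ = inj₂ (≐-true (∧-conicalˡ (s ≐ b) (t ≐ a) e′) , ≐-true (∧-conicalʳ (s ≐ b) (t ≐ a) e′))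

  link-source : ∀ a b s t → link a b s t ≡ true → s ≡ a ⊎ s ≡ b
  link-source a b s t e with link-true a b s t e
  ... | inj₁ (s≡a , _) = inj₁ s≡a
  ... | inj₂ (s≡b , _) = inj₂ s≡b

  link-functional : ∀ a b s {t x} → link a b s t ≡ true → link a b s x ≡ true → t ≡ x
  link-functional a b s {t} {x} st sx with link-true a b s t st | link-true a b s x sx
  ... | inj₁ (refl , refl) | inj₁ (_ , refl)    = refl
  ... | inj₁ (refl , refl) | inj₂ (a≡b , refl)  = sym a≡b
  ... | inj₂ (refl , refl) | inj₁ (b≡a , refl)  = sym b≡a
  ... | inj₂ (refl , refl) | inj₂ (_ , refl)    = refl

  ∑∑-link : ∀ {a b} → a ≢ b → ∑∑ (λ s t → 𝟙 (link a b s t)) ≡ 2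
  ∑∑-link {a} {b} a≢b = begin
      ∑∑ (λ s t → 𝟙 (link a b s t))
    ≡⟨ ∑∑-cong (λ s t → 𝟙-∨ (both-ends s t)) ⟩
      ∑∑ (λ s t → 𝟙 (s ≐ a ∧ t ≐ b) + 𝟙 (s ≐ b ∧ t ≐ a))
    ≡⟨ ∑∑-+ (λ s t → 𝟙 (s ≐ a ∧ t ≐ b)) (λ s t → 𝟙 (s ≐ b ∧ t ≐ a)) ⟩
      ∑∑ (λ s t → 𝟙 (s ≐ a ∧ t ≐ b)) + ∑∑ (λ s t → 𝟙 (s ≐ b ∧ t ≐ a))
    ≡⟨ cong₂ _+_ (∑∑-point a b) (∑∑-point b a) ⟩
      2 ∎
    where
    open ≡-Reasoning
    both-ends : ∀ s t → s ≐ a ∧ t ≐ b ≡ true → s ≐ b ∧ t ≐ a ≡ true → ⊥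
    both-ends s t e e′ =
      a≢b (trans (sym (≐-true {s} (∧-conicalˡ (s ≐ a) (t ≐ b) e))) (≐-true {s} (∧-conicalˡ (s ≐ b) _ e′)))

module _ {n : ℕ} {H : Graph n} where

  inM-sym : (M : Matching H) → ∀ {u v} → inM M u v ≡ true → inM M v u ≡ true
  inM-sym M {u} {v} uv = trans (msym M v u) uv

  inM-irrefl : (M : Matching H) → ∀ u → inM M u u ≡ false
  inM-irrefl M u with inM M u u in uu
  ... | true  = ⊥-elim (adj⇒≢ H (medge M u u uu) refl)
  ... | false = refl

  partner-unique : (M : Matching H) → ∀ {u v x} → inM M u v ≡ true → inM M u x ≡ true → v ≡ x
  partner-unique M {u} {v} {x} = mdisj M u v x

  saturated? : (M : Matching H) → ∀ v → Dec (Saturates M v)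
  saturated? M v = any? (λ u → inM M v u ≟ᵇ true)

  pairCount : Matching H → ℕ
  pairCount M = ∑∑ (λ u v → 𝟙 (inM M u v))

  double-msize : (M : Matching H) → 2 * msize M ≡ pairCount M
  double-msize M = double-length-upperPairs (inM M) (msym M) (inM-irrefl M)

  ∑-inM-saturated : (M : Matching H) → ∀ {u p} → inM M u p ≡ true → ∑ (λ v → 𝟙 (inM M u v)) ≡ 1
  ∑-inM-saturated M {u} {p} up = trans (∑-single _ p not-partner) (cong 𝟙 up)
    where
    not-partner : ∀ v → v ≢ p → 𝟙 (inM M u v) ≡ 0
    not-partner v v≢p with inM M u v in uv
    ... | true  = ⊥-elim (v≢p (partner-unique M uv up))
    ... | false = refl

  ∑-inM-unsaturated : (M : Matching H) → ∀ {u} → ¬ Saturates M u → ∑ (λ v → 𝟙 (inM M u v)) ≡ 0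
  ∑-inM-unsaturated M {u} u-free = ∑-zero not-partner
    where
    not-partner : ∀ v → 𝟙 (inM M u v) ≡ 0
    not-partner v with inM M u v in uv
    ... | true  = ⊥-elim (u-free (v , uv))
    ... | false = refl

  link-avoids : (M : Matching H) → ∀ {a b} → ¬ Saturates M a → ¬ Saturates M b →
    ∀ s t x → inM M s t ≡ true → link a b s x ≡ true → ⊥
  link-avoids M {a} {b} a-free b-free s t x st sx with link-source a b s x sx
  ... | inj₁ refl = a-free (t , st)
  ... | inj₂ refl = b-free (t , st)

  extend : (M : Matching H) (a b : Fin n) → adj H a b ≡ true →
           ¬ Saturates M a → ¬ Saturates M b → Matching H
  extend M a b ab a-free b-free = record
    { inM   = λ s t → inM M s t ∨ link a b s t
    ; msym  = λ s t → cong₂ _∨_ (msym M s t) (link-sym a b s t)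
    ; medge = edge
    ; mdisj = disjoint
    }
    where
    edge : ∀ s t → inM M s t ∨ link a b s t ≡ true → adj H s t ≡ true
    edge s t e with ∨-true {inM M s t} e
    ... | inj₁ st = medge M s t st
    ... | inj₂ st with link-true a b s t st
    ...   | inj₁ (refl , refl) = ab
    ...   | inj₂ (refl , refl) = adj-sym H ab
    not-both = link-avoids M a-free b-free
    disjoint : ∀ s t x → inM M s t ∨ link a b s t ≡ true → inM M s x ∨ link a b s x ≡ true → t ≡ x
    disjoint s t x e e′ with ∨-true {inM M s t} e | ∨-true {inM M s x} e′
    ... | inj₁ st | inj₁ sx = mdisj M s t x st sx
    ... | inj₁ st | inj₂ sx = ⊥-elim (not-both s t x st sx)
    ... | inj₂ st | inj₁ sx = ⊥-elim (not-both s x t sx st)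
    ... | inj₂ st | inj₂ sx = link-functional a b s st sx

  pairCount-extend : (M : Matching H) (a b : Fin n) (ab : adj H a b ≡ true)
    (a-free : ¬ Saturates M a) (b-free : ¬ Saturates M b) →
    pairCount (extend M a b ab a-free b-free) ≡ pairCount M + 2
  pairCount-extend M a b ab a-free b-free = begin
      ∑∑ (λ s t → 𝟙 (inM M s t ∨ link a b s t))
    ≡⟨ ∑∑-cong (λ s t → 𝟙-∨ (link-avoids M a-free b-free s t t)) ⟩
      ∑∑ (λ s t → 𝟙 (inM M s t) + 𝟙 (link a b s t))
    ≡⟨ ∑∑-+ (λ s t → 𝟙 (inM M s t)) (λ s t → 𝟙 (link a b s t)) ⟩
      pairCount M + ∑∑ (λ s t → 𝟙 (link a b s t))
    ≡⟨ cong (pairCount M +_) (∑∑-link (adj⇒≢ H ab)) ⟩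
      pairCount M + 2 ∎
    where open ≡-Reasoning

  detach : Matching H → Fin n → Matching H
  detach M a = record
    { inM   = λ s t → inM M s t ∧ not (s ≐ a ∨ t ≐ a)
    ; msym  = λ s t → cong₂ _∧_ (msym M s t) (cong not (∨-comm (s ≐ a) (t ≐ a)))
    ; medge = λ s t e → medge M s t (∧-conicalˡ _ _ e)
    ; mdisj = λ s t x e e′ → mdisj M s t x (∧-conicalˡ _ _ e) (∧-conicalˡ _ _ e′)
    }

  detach-⊆ : (M : Matching H) (a : Fin n) → ∀ {s t} → inM (detach M a) s t ≡ true → inM M s t ≡ true
  detach-⊆ M a e = ∧-conicalˡ _ _ e

  detach-frees : (M : Matching H) (a : Fin n) → ¬ Saturates (detach M a) a
  detach-frees M a (t , e)
    with trans (sym (∧-conicalʳ (inM M a t) _ e)) (cong (λ c → not (c ∨ t ≐ a)) (≐-refl a))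
  ... | ()

  detach-unsaturated : (M : Matching H) (a : Fin n) → ∀ {c} → ¬ Saturates M c → ¬ Saturates (detach M a) c
  detach-unsaturated M a c-free (t , ct) = c-free (t , detach-⊆ M a ct)

  edges-at : (M : Matching H) → ∀ {a b} → inM M a b ≡ true →
    ∀ s t → inM M s t ∧ (s ≐ a ∨ t ≐ a) ≡ link a b s t
  edges-at M {a} {b} ab s t = ⇔→≡ {z = true} (mk⇔ to from)
    where
    to : inM M s t ∧ (s ≐ a ∨ t ≐ a) ≡ true → link a b s t ≡ true
    to e with ∨-true {s ≐ a} (∧-conicalʳ (inM M s t) _ e)
    ... | inj₁ s≐a rewrite ≐-true {s = s} s≐a
                         | partner-unique M (∧-conicalˡ _ _ e) ab = link-refl a b
    ... | inj₂ t≐a rewrite ≐-true {s = t} t≐a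
                         | partner-unique M (inM-sym M (∧-conicalˡ _ _ e)) ab =
                             trans (link-sym a b b a) (link-refl a b)
    from : link a b s t ≡ true → inM M s t ∧ (s ≐ a ∨ t ≐ a) ≡ true
    from e with link-true a b s t e
    ... | inj₁ (refl , refl) rewrite ab | ≐-refl a = refl
    ... | inj₂ (refl , refl) rewrite inM-sym M ab | ≐-refl a | ∨-zeroʳ (b ≐ a) = refl

  pairCount-detach : (M : Matching H) → ∀ {a b} → inM M a b ≡ true →
    pairCount M ≡ pairCount (detach M a) + 2
  pairCount-detach M {a} {b} ab = begin
      pairCount M
    ≡⟨ ∑∑-cong (λ s t → 𝟙-split (inM M s t) (s ≐ a ∨ t ≐ a)) ⟩
      ∑∑ (λ s t → 𝟙 (inM M s t ∧ not (s ≐ a ∨ t ≐ a)) + 𝟙 (inM M s t ∧ (s ≐ a ∨ t ≐ a)))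
    ≡⟨ ∑∑-+ (λ s t → 𝟙 (inM M s t ∧ not (s ≐ a ∨ t ≐ a))) (λ s t → 𝟙 (inM M s t ∧ (s ≐ a ∨ t ≐ a))) ⟩
      pairCount (detach M a) + ∑∑ (λ s t → 𝟙 (inM M s t ∧ (s ≐ a ∨ t ≐ a)))
    ≡⟨ cong (pairCount (detach M a) +_) (∑∑-cong (λ s t → cong 𝟙 (edges-at M ab s t))) ⟩
      pairCount (detach M a) + ∑∑ (λ s t → 𝟙 (link a b s t))
    ≡⟨ cong (pairCount (detach M a) +_) (∑∑-link (adj⇒≢ H (medge M a b ab))) ⟩
      pairCount (detach M a) + 2 ∎
    where open ≡-Reasoning

  rematch : (M : Matching H) (a c : Fin n) → adj H a c ≡ true → ¬ Saturates M c → Matching H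
  rematch M a c ac c-free =
    extend (detach M a) a c ac (detach-frees M a) (detach-unsaturated M a c-free)

  msize-rematch : (M : Matching H) → ∀ {a b c} → inM M a b ≡ true →
    (ac : adj H a c ≡ true) (c-free : ¬ Saturates M c) → msize (rematch M a c ac c-free) ≡ msize M
  msize-rematch M {a} {b} {c} ab ac c-free = *-cancelˡ-≡ _ _ 2 (begin
      2 * msize (rematch M a c ac c-free)
    ≡⟨ double-msize (rematch M a c ac c-free) ⟩
      pairCount (rematch M a c ac c-free)
    ≡⟨ pairCount-extend (detach M a) a c ac (detach-frees M a) (detach-unsaturated M a c-free) ⟩
      pairCount (detach M a) + 2
    ≡⟨ pairCount-detach M ab ⟨
      pairCount M
    ≡⟨ double-msize M ⟨
      2 * msize M ∎)
    where open ≡-Reasoning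

  rematch-keeps : (M : Matching H) → ∀ {a c} (ac : adj H a c ≡ true) (c-free : ¬ Saturates M c) →
    ∀ {s t} → inM M s t ≡ true → s ≢ a → t ≢ a → inM (rematch M a c ac c-free) s t ≡ true
  rematch-keeps M ac c-free st s≢a t≢a rewrite st | ≐-false s≢a | ≐-false t≢a = refl

  rematch-unsaturated : (M : Matching H) → ∀ {a c} (ac : adj H a c ≡ true) (c-free : ¬ Saturates M c) →
    ∀ {s} → (∀ t → inM M s t ≡ true → t ≡ a) → s ≢ a → s ≢ c → ¬ Saturates (rematch M a c ac c-free) s
  rematch-unsaturated M {a} {c} ac c-free {s} only-a s≢a s≢c (t , st) =
    [ via-detach , via-link ] (∨-true {inM (detach M a) s t} st)
    where
    via-detach : inM (detach M a) s t ≡ true → ⊥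
    via-detach st′ with only-a t (detach-⊆ M a st′)
    ... | refl = detach-frees M a (s , inM-sym (detach M a) st′)
    via-link : link a c s t ≡ true → ⊥
    via-link st′ = [ s≢a , s≢c ] (link-source a c s t st′)

  -- Maximum matchings

  pairCount-maximum : (M : Matching H) → IsMaximum M → ∀ M′ → pairCount M′ ≤ pairCount M
  pairCount-maximum M maximum M′ =
    subst₂ _≤_ (double-msize M′) (double-msize M) (*-monoʳ-≤ 2 (maximum M′))

  rematch-maximum : (M : Matching H) → IsMaximum M → ∀ {a b c} → inM M a b ≡ true →
    (ac : adj H a c ≡ true) (c-free : ¬ Saturates M c) → IsMaximum (rematch M a c ac c-free)
  rematch-maximum M maximum ab ac c-free M′ =
    subst (msize M′ ≤_) (sym (msize-rematch M ab ac c-free)) (maximum M′)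

  maximum⇒maximal : (M : Matching H) → IsMaximum M → IsMaximal M
  maximum⇒maximal M maximum u v uv with saturated? M u | saturated? M v
  ... | yes u-sat | _       = inj₁ u-sat
  ... | no _      | yes v-sat = inj₂ v-sat
  ... | no u-free | no v-free = ⊥-elim (<-irrefl refl (begin-strict
      pairCount M
    <⟨ m<m+n (pairCount M) (s≤s z≤n) ⟩
      pairCount M + 2
    ≡⟨ pairCount-extend M u v uv u-free v-free ⟨
      pairCount (extend M u v uv u-free v-free)
    ≤⟨ pairCount-maximum M maximum (extend M u v uv u-free v-free) ⟩
      pairCount M ∎))
    where open ≤-Reasoning

  saturated≢unsaturated : (M : Matching H) → ∀ {u x} → Saturates M u → ¬ Saturates M x → u ≢ x
  saturated≢unsaturated M u-sat x-free refl = x-free u-sat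

  unsaturated⇒Leaf : RandomlyInternallyMatchable H → (M : Matching H) → IsMaximum M →
    ∀ {v} → ¬ Saturates M v → Leaf H v
  unsaturated⇒Leaf rim M maximum {v} v-free with 2 ≤? deg H v
  ... | yes internal = ⊥-elim (v-free (rim M (maximum⇒maximal M maximum) v internal))
  ... | no  external = ≤-pred (≰⇒> external)

  no-augmenting-path : (M : Matching H) → IsMaximum M → ∀ {x u p z} →
    ¬ Saturates M x → adj H x u ≡ true → inM M u p ≡ true → adj H p z ≡ true →
    ¬ Saturates M z → x ≢ z → ⊥
  no-augmenting-path M maximum {x} {u} {p} {z} x-free xu up pz z-free x≢z =
    [ p-free₁ , z-free₁ ] (maximum⇒maximal M₁ (rematch-maximum M maximum up ux x-free) p z pz)
    where
    ux = adj-sym H xu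
    M₁ = rematch M u x ux x-free
    p-free₁ : ¬ Saturates M₁ p
    p-free₁ = rematch-unsaturated M ux x-free (λ t pt → partner-unique M pt (inM-sym M up))
      (adj⇒≢ H (medge M u p up) ∘ sym) (saturated≢unsaturated M (u , inM-sym M up) x-free)
    z-free₁ : ¬ Saturates M₁ z
    z-free₁ = rematch-unsaturated M ux x-free (λ t zt → ⊥-elim (z-free (t , zt)))
      (saturated≢unsaturated M (p , up) z-free ∘ sym) (x≢z ∘ sym)

  alternating-path-ends-at-leaf : RandomlyInternallyMatchable H → (M : Matching H) → IsMaximum M →
    ∀ {x p u v q} → ¬ Saturates M x → adj H x p ≡ true → inM M p u ≡ true → adj H u v ≡ true →
    inM M v q ≡ true → v ≢ p → Leaf H q
  alternating-path-ends-at-leaf rim M maximum {x} {p} {u} {v} {q} x-free xp pu uv vq v≢p =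
    unsaturated⇒Leaf rim M₂ (rematch-maximum M₁ maximum₁ vq₁ vu u-free₁) q-free₂
    where
    px = adj-sym H xp
    vu = adj-sym H uv
    M₁ = rematch M p x px x-free
    maximum₁ = rematch-maximum M maximum pu px x-free
    u-free₁ : ¬ Saturates M₁ u
    u-free₁ = rematch-unsaturated M px x-free (λ t ut → partner-unique M ut (inM-sym M pu))
      (adj⇒≢ H (medge M p u pu) ∘ sym) (saturated≢unsaturated M (p , inM-sym M pu) x-free)
    q≢p : q ≢ p
    q≢p refl = adj⇒≢ H uv (partner-unique M pu (inM-sym M vq))
    q≢u : q ≢ u
    q≢u refl = v≢p (partner-unique M (inM-sym M vq) (inM-sym M pu))
    vq₁ : inM M₁ v q ≡ true
    vq₁ = rematch-keeps M px x-free vq v≢p q≢p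
    M₂ = rematch M₁ v u vu u-free₁
    q-free₂ : ¬ Saturates M₂ q
    q-free₂ = rematch-unsaturated M₁ vu u-free₁ (λ t qt → partner-unique M₁ qt (inM-sym M₁ vq₁))
      (adj⇒≢ H (medge M v q vq) ∘ sym) q≢u

-- The fractional vertex cover of a maximum matching

module _ {n : ℕ} {H : Graph n} where

  HasLeafNeighbour : Fin n → Set
  HasLeafNeighbour u = ∃ λ x → adj H u x ≡ true × Leaf H x

  hasLeafNeighbour? : ∀ u → Dec (HasLeafNeighbour u)
  hasLeafNeighbour? u = any? (λ x → (adj H u x ≟ᵇ true) ×-dec (deg H x ≤? 1))

  share : Fin n → Fin n → ℕ
  share u p = weigh (hasLeafNeighbour? u) (hasLeafNeighbour? p)
    where
    weigh : ∀ {A B : Set} → Dec A → Dec B → ℕ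
    weigh (yes _) (no _)  = 2
    weigh (no _)  (yes _) = 0
    weigh _       _       = 1

  share-+ : ∀ u p → share u p + share p u ≡ 2
  share-+ u p with hasLeafNeighbour? u | hasLeafNeighbour? p
  ... | yes _ | yes _ = refl
  ... | yes _ | no _  = refl
  ... | no _  | yes _ = refl
  ... | no _  | no _  = refl

  share-two : ∀ {u p} → HasLeafNeighbour u → ¬ HasLeafNeighbour p → share u p ≡ 2
  share-two {u} {p} u-leafy p-bare with hasLeafNeighbour? u | hasLeafNeighbour? p
  ... | yes _ | no _       = refl
  ... | no ¬u-leafy | _    = ⊥-elim (¬u-leafy u-leafy)
  ... | yes _ | yes p-leafy = ⊥-elim (p-bare p-leafy)

  share-zero : ∀ {u p} → share u p ≡ 0 → HasLeafNeighbour p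
  share-zero {u} {p} e with hasLeafNeighbour? u | hasLeafNeighbour? p
  ... | _     | yes p-leafy = p-leafy
  ... | yes _ | no _        = ⊥-elim (1+n≢0 e)
  ... | no _  | no _        = ⊥-elim (1+n≢0 e)

  cover : Matching H → Fin n → ℕ
  cover M u with saturated? M u
  ... | yes (p , _) = share u p
  ... | no _        = 0

  cover-partner : (M : Matching H) → ∀ {u p} → inM M u p ≡ true → cover M u ≡ share u p
  cover-partner M {u} {p} up with saturated? M u
  ... | yes (p′ , up′) = cong (share u) (partner-unique M up′ up)
  ... | no u-free      = ⊥-elim (u-free (p , up))

  cover-unsaturated : (M : Matching H) → ∀ {u} → ¬ Saturates M u → cover M u ≡ 0
  cover-unsaturated M {u} u-free with saturated? M u
  ... | yes u-sat = ⊥-elim (u-free u-sat)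
  ... | no _      = refl

  ∑-cover : (M : Matching H) → ∑ (cover M) ≡ 2 * msize M
  ∑-cover M = *-cancelˡ-≡ _ _ 2 (begin
      2 * ∑ y
    ≡⟨ cong (2 *_) (sum-cong-≗ y≡y*row) ⟩
      2 * ∑ (λ u → y u * ∑ (B u))
    ≡⟨ ∑∑-weighted-sym B (λ u v → cong 𝟙 (msym M u v)) y ⟨
      ∑∑ (λ u v → (y u + y v) * B u v)
    ≡⟨ ∑∑-cong matched-pairs ⟩
      ∑∑ (λ u v → 2 * B u v)
    ≡⟨ ∑∑-*ˡ 2 B ⟩
      2 * pairCount M
    ≡⟨ cong (2 *_) (double-msize M) ⟨
      2 * (2 * msize M) ∎)
    where
    open ≡-Reasoning
    y = cover M
    B : Fin n → Fin n → ℕ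
    B u v = 𝟙 (inM M u v)
    y≡y*row : ∀ u → y u ≡ y u * ∑ (B u)
    y≡y*row u = case saturated? M u of λ where
      (yes (p , up)) → sym (trans (cong (y u *_) (∑-inM-saturated M up)) (*-identityʳ (y u)))
      (no u-free)    → trans (cover-unsaturated M u-free)
                             (sym (trans (cong (y u *_) (∑-inM-unsaturated M u-free)) (*-zeroʳ (y u))))
    matched-pairs : ∀ u v → (y u + y v) * B u v ≡ 2 * B u v
    matched-pairs u v with inM M u v in uv
    ... | true  = cong (_* 1) (trans (cong₂ _+_ (cover-partner M uv) (cover-partner M (inM-sym M uv)))
                                     (share-+ u v))
    ... | false = *-zeroʳ (y u + y v)

  leaf-beside-matched-is-unsaturated : (M : Matching H) → ∀ {u p z} → inM M u p ≡ true → ¬ Leaf H u →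
    adj H p z ≡ true → Leaf H z → ¬ Saturates M z
  leaf-beside-matched-is-unsaturated M up ¬u-leaf pz z-leaf (r , zr)
    with leaf-neighbour-unique H z-leaf (medge M _ r zr) (adj-sym H pz)
  ... | refl with partner-unique M (inM-sym M zr) (inM-sym M up)
  ...   | refl = ¬u-leaf z-leaf

  module _ (rim : RandomlyInternallyMatchable H) (M : Matching H) (maximum : IsMaximum M) where

    cover-beside-unsaturated : ∀ {u p v} → inM M u p ≡ true → adj H u v ≡ true → ¬ Saturates M v →
      cover M u ≡ 2
    cover-beside-unsaturated {u} {p} {v} up uv v-free =
      trans (cover-partner M up) (share-two (v , uv , v-leaf) p-bare)
      where
      v-leaf = unsaturated⇒Leaf rim M maximum v-free
      p≢v : p ≢ v
      p≢v = saturated≢unsaturated M (u , inM-sym M up) v-free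
      ¬u-leaf : ¬ Leaf H u
      ¬u-leaf = two-neighbours⇒¬Leaf H (medge M u p up) uv p≢v
      p-bare : ¬ HasLeafNeighbour p
      p-bare (z , pz , z-leaf) with z ≟ v
      ... | yes refl = two-neighbours⇒¬Leaf H (adj-sym H uv) (adj-sym H pz) (adj⇒≢ H (medge M u p up)) v-leaf
      ... | no z≢v   = no-augmenting-path M maximum v-free (adj-sym H uv) up pz
                         (leaf-beside-matched-is-unsaturated M up ¬u-leaf pz z-leaf) (z≢v ∘ sym)

    cover-zero-beside : ∀ {u p v q} → inM M u p ≡ true → inM M v q ≡ true → adj H u v ≡ true → v ≢ p →
      cover M u ≡ 0 → cover M v ≡ 2
    cover-zero-beside {u} {p} {v} {q} up vq uv v≢p u-zero
      with share-zero (trans (sym (cover-partner M up)) u-zero)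
    ... | x , px , x-leaf = trans (cover-partner M vq) (share-two (q , medge M v q vq , q-leaf) q-bare)
      where
      ¬u-leaf : ¬ Leaf H u
      ¬u-leaf = two-neighbours⇒¬Leaf H (medge M u p up) uv (v≢p ∘ sym)
      x-free : ¬ Saturates M x
      x-free = leaf-beside-matched-is-unsaturated M up ¬u-leaf px x-leaf
      q-leaf : Leaf H q
      q-leaf = alternating-path-ends-at-leaf rim M maximum x-free (adj-sym H px) (inM-sym M up) uv vq v≢p
      q≢u : q ≢ u
      q≢u refl = v≢p (partner-unique M (inM-sym M vq) up)
      q-bare : ¬ HasLeafNeighbour q
      q-bare (z , qz , z-leaf) with leaf-neighbour-unique H q-leaf qz (adj-sym H (medge M v q vq))
      ... | refl = two-neighbours⇒¬Leaf H (adj-sym H (medge M q z (inM-sym M vq))) (adj-sym H uv) q≢u z-leaf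

    cover-covers : DoubledFractionalCover H (cover M)
    cover-covers u v uv = by-saturation (saturated? M u) (saturated? M v)
      where
      two≤ : ∀ {a b} → a ≡ 2 → 2 ≤ a + b
      two≤ {b = b} refl = m≤m+n 2 b
      two≤′ : ∀ {a b} → b ≡ 2 → 2 ≤ a + b
      two≤′ {a} refl = m≤n+m 2 a
      by-saturation : Dec (Saturates M u) → Dec (Saturates M v) → 2 ≤ cover M u + cover M v
      by-saturation (no u-free) (no v-free) = ⊥-elim ([ u-free , v-free ] (maximum⇒maximal M maximum u v uv))
      by-saturation (yes (p , up)) (no v-free) = two≤ (cover-beside-unsaturated up uv v-free)
      by-saturation (no u-free) (yes (q , vq)) = two≤′ (cover-beside-unsaturated vq (adj-sym H uv) u-free)
      by-saturation (yes (p , up)) (yes (q , vq)) with v ≟ p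
      ... | yes refl = ≤-reflexive (sym (trans
              (cong₂ _+_ (cover-partner M up) (cover-partner M (inM-sym M up))) (share-+ u v)))
      ... | no v≢p with cover M u ≟ℕ 0 | cover M v ≟ℕ 0
      ...   | yes u-zero | _ = two≤′ (cover-zero-beside up vq uv v≢p u-zero)
      ...   | no _ | yes v-zero = two≤ (cover-zero-beside vq up (adj-sym H uv) u≢q v-zero)
        where u≢q : u ≢ q
              u≢q refl = v≢p (sym (partner-unique M up (inM-sym M vq)))
      ...   | no u≢0 | no v≢0 = +-mono-≤ (n≢0⇒n>0 u≢0) (n≢0⇒n>0 v≢0)

lemma16 : ∀ {n : ℕ} (H : Graph n) (w : Weighting H) →
    Connected H → RandomlyInternallyMatchable H →
    (M : Matching H) → IsMaximum M →
    totalWeight H w ≤ maxWDeg H w * msize M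
lemma16 H w _ rim M maximum = *-cancelˡ-≤ 2 (begin
    2 * totalWeight H w
  ≤⟨ totalWeight-≤-cover H w (cover M) (cover-covers rim M maximum) ⟩
    Δ * ∑ (cover M)
  ≡⟨ cong (Δ *_) (∑-cover M) ⟩
    Δ * (2 * msize M)
  ≡⟨ *-assoc Δ 2 (msize M) ⟨
    Δ * 2 * msize M
  ≡⟨ cong (_* msize M) (*-comm Δ 2) ⟩
    2 * Δ * msize M
  ≡⟨ *-assoc 2 Δ (msize M) ⟩
    2 * (Δ * msize M) ∎)
  where
  open ≤-Reasoning
  Δ = maxWDeg H w
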